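{- Consider one-dimensional Internal Diffusion Limited Aggregation on $\mathbb{Z}$, defined as follows. Initially the set of occupied sites is $\{0\}$. Particles are released one at a time at the origin; each particle performs a simple symmetric random walk on $\mathbb{Z}$ (each step is determined by a fair coin toss: $+1$ or $-1$ with probability $\tfrac12$ each, independently) until it first reaches an unoccupied site, at which point it stops, that site becomes occupied, and the next particle is released at the origin. For $n \ge 1$ let $E_n$ denote the expected total number of coin tosses (random walk steps, summed over all particles) needed until there are $n$ occupied sites. Then for every $n \geq 1$, \[ E_n = \frac{1}{12} n^3 + \frac{1}{12} n^2. \] -}

module Defs where

open import Data.Bool using (Bool; true; false; if_then_else_; not; _∧_)
open import Data.Nat as ℕ using (ℕ; zero; suc; _^_; _≤ᵇ_)
open import Data.Nat.Properties using (m^n≢0)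
open import Data.Integer as ℤ using (ℤ; +_; 0ℤ)
open import Data.List using (List; []; _∷_; length; map; filter; foldl; take; upTo; _++_; concatMap)
open import Data.Bool.ListAction using (any)
open import Data.List.Membership.DecPropositional ℤ._≟_ using (_∈?_)
open import Relation.Nullary.Decidable using (does)
open import Data.Rational as ℚ using (ℚ; 0ℚ)

record State : Set where
  constructor st
  field
    occupied : List ℤ
    walker   : ℤ
open State public

initial : State
initial = st (0ℤ ∷ []) 0ℤ

step : State → Bool → State
step (st occ p) b with (if b then p ℤ.+ + 1 else p ℤ.- + 1)
... | p' = if does (p' ∈? occ) then st occ p' else st (p' ∷ occ) 0ℤ

run : List Bool → State
run = foldl step initial

size : List Bool → ℕ
size s = length (occupied (run s))

seqs : ℕ → List (List Bool)
seqs zero    = [] ∷ []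
seqs (suc t) = concatMap (λ s → (true ∷ s) ∷ (false ∷ s) ∷ []) (seqs t)

-- "n sites are first occupied exactly after the last toss of s",
-- i.e. the hitting time T_n equals length s on this toss sequence.
firstHit : ℕ → List Bool → Bool
firstHit n s =
  (n ≤ᵇ size s) ∧ not (any (λ k → n ≤ᵇ size (take k s)) (upTo (length s)))

probT : ℕ → ℕ → ℚ
probT n t =
  ℚ._/_ (+ length (filter (λ s → firstHit n s Data.Bool.≟ true) (seqs t)))
        (2 ^ t) {{m^n≢0 2 t}}
  where import Data.Bool

sumUpTo : (ℕ → ℚ) → ℕ → ℚ
sumUpTo f zero    = 0ℚ
sumUpTo f (suc N) = sumUpTo f N ℚ.+ f N

massUpTo : ℕ → ℕ → ℚ
massUpTo n = sumUpTo (probT n)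

expUpTo : ℕ → ℕ → ℚ
expUpTo n = sumUpTo (λ t → (+ t ℚ./ 1) ℚ.* probT n t)

_⟶_ : (ℕ → ℚ) → ℚ → Set
a ⟶ L = ∀ (ε : ℚ) → 0ℚ ℚ.< ε →
  Data.Product.∃ λ N → ∀ M → N ℕ.≤ M → ℚ.∣ a M ℚ.- L ∣ ℚ.< ε
  where import Data.Product

module Submission where

-- Let the occupied set be the interval [-a, b], K = a + b + 1 its size, D = b - a its balance
-- and P the walker's position.  The polynomial
--   Φₙ(K, D, P) = n(n³ - n - K³ + K) - 3K(n - K)D² + 12P(KD - (n - 1)P)
-- is 12(n - 1) times the expected number of tosses still needed to occupy n sites: a toss only
-- changes P, and the second difference in P makes Φₙ drop by exactly 12(n - 1) on average; a
-- particle settling at b + 1 or -(a + 1) leaves Φₙ unchanged; and Φₙ vanishes when K = n and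
-- P = 0.  So 12(n - 1)t + Φₙ is a martingale up to the hitting time T, and summing over the 2ᵗ toss
-- sequences of length t gives, exactly,
--   12(n - 1) Σ_{t' ≤ t} t' P(T = t') + E[12(n - 1)t + Φₙ ; T > t] = Φₙ(1, 0, 0) = (n - 1)(n³ + n²).
-- From any configuration n² heads in a row occupy n sites, so P(T > t) decays geometrically; as Φₙ
-- is bounded on configurations with fewer than n sites, the second term tends to 0.  Hence
-- P(T ≤ t) → 1 and E[T] = (n³ + n²)/12.

open import Defs

open import Algebra.Core using (Op₂)
open import Algebra.Structures using (IsSemiring)
open import Data.Bool as Bool using (Bool; true; false; T; not; _∧_; _∨_; if_then_else_)
open import Data.Bool.ListAction using (any)
import Data.Bool.Properties as Boolₚ
open import Data.Empty using (⊥-elim)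
open import Data.Fin.Patterns using (0F; 1F; 2F; 3F)
open import Data.Integer as ℤ using (ℤ; +_; -[1+_]; +[1+_]; 0ℤ; 1ℤ; -1ℤ)
import Data.Integer.Properties as ℤₚ
open import Data.Integer.Solver using (module +-*-Solver)
open import Data.Integer.Tactic.RingSolver using (solve-∀)
open import Data.List using (List; []; _∷_; _++_; _∷ʳ_; length; filter; concatMap; replicate; take; upTo; foldl)
open import Data.List.Membership.DecPropositional ℤ._≟_ using (_∈?_)
open import Data.List.Membership.Propositional using (_∈_; _∉_)
open import Data.List.Membership.Propositional.Properties using (∈-concatMap⁺)
import Data.List.Properties as Listₚ
open import Data.List.Relation.Unary.Any as Any using (here; there)
open import Data.Nat as ℕ using (ℕ; zero; suc; pred; _+_; _*_; _^_; _∸_; _≤_; _<_; _≤ᵇ_; z≤n; s≤s; z<s; NonZero)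
import Data.Nat.DivMod as DivMod
open import Data.Nat.Properties
open import Algebra.Properties.CommutativeSemigroup *-commutativeSemigroup using (x∙yz≈y∙xz)
import Data.Nat.Tactic.RingSolver as ℕ-Solver
open import Data.Product using (∃-syntax; _×_; _,_; proj₁; proj₂; uncurry)
open import Data.Rational as ℚ using (ℚ; mkℚ; _/_; 0ℚ; ↧ₙ_)
open import Data.Rational.Properties as ℚₚ
  using ( toℚᵘ-injective; fromℚᵘ-cong; toℚᵘ-fromℚᵘ; toℚᵘ-cancel-<
        ; toℚᵘ-homo-+; toℚᵘ-homo-*; toℚᵘ-homo‿-; toℚᵘ-homo-∣-∣ )
open import Data.Rational.Unnormalised as ℚᵘ using (mkℚᵘ; _≃_; *≡*; *<*)
import Data.Rational.Unnormalised.Properties as ℚᵘₚ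
open import Data.Sum using (_⊎_; inj₁; inj₂)
open import Data.Vec using (Vec; []; _∷_; lookup)
open import Function using (_∘_; Equivalence)
open import Relation.Binary.PropositionalEquality
open import Relation.Nullary using (yes; no)

𝟙 : Bool → ℕ
𝟙 true  = 1
𝟙 false = 0

𝟙≤1 : ∀ b → 𝟙 b ≤ 1
𝟙≤1 true  = ≤-refl
𝟙≤1 false = z≤n

module ListSum {A : Set} {_⊕_ _⊗_ : Op₂ A} {0# 1# : A}
               (isSemiring : IsSemiring _≡_ _⊕_ _⊗_ 0# 1#) where

  private module S = IsSemiring isSemiring
  open ≡-Reasoning

  ∑ : {X : Set} → List X → (X → A) → A
  ∑ []       f = 0#
  ∑ (x ∷ xs) f = f x ⊕ ∑ xs f

  module _ {X : Set} where

    ∑-cong : ∀ (xs : List X) {f g} → (∀ x → f x ≡ g x) → ∑ xs f ≡ ∑ xs g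
    ∑-cong []       f≗g = refl
    ∑-cong (x ∷ xs) f≗g = cong₂ _⊕_ (f≗g x) (∑-cong xs f≗g)

    ∑-0# : ∀ (xs : List X) → ∑ xs (λ _ → 0#) ≡ 0#
    ∑-0# []       = refl
    ∑-0# (x ∷ xs) = trans (cong (0# ⊕_) (∑-0# xs)) (S.+-identityˡ 0#)

    ∑-++ : ∀ (xs ys : List X) f → ∑ (xs ++ ys) f ≡ ∑ xs f ⊕ ∑ ys f
    ∑-++ []       ys f = sym (S.+-identityˡ _)
    ∑-++ (x ∷ xs) ys f = trans (cong (f x ⊕_) (∑-++ xs ys f)) (sym (S.+-assoc _ _ _))

    ∑-⊕ : ∀ (xs : List X) f g → ∑ xs (λ x → f x ⊕ g x) ≡ ∑ xs f ⊕ ∑ xs g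
    ∑-⊕ []       f g = sym (S.+-identityˡ 0#)
    ∑-⊕ (x ∷ xs) f g = begin
      (f x ⊕ g x) ⊕ ∑ xs (λ x → f x ⊕ g x) ≡⟨ cong ((f x ⊕ g x) ⊕_) (∑-⊕ xs f g) ⟩
      (f x ⊕ g x) ⊕ (∑ xs f ⊕ ∑ xs g)       ≡⟨ S.+-assoc _ _ _ ⟩
      f x ⊕ (g x ⊕ (∑ xs f ⊕ ∑ xs g))       ≡⟨ cong (f x ⊕_) (sym (S.+-assoc _ _ _)) ⟩
      f x ⊕ ((g x ⊕ ∑ xs f) ⊕ ∑ xs g)       ≡⟨ cong (λ y → f x ⊕ (y ⊕ ∑ xs g)) (S.+-comm _ _) ⟩
      f x ⊕ ((∑ xs f ⊕ g x) ⊕ ∑ xs g)       ≡⟨ cong (f x ⊕_) (S.+-assoc _ _ _) ⟩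
      f x ⊕ (∑ xs f ⊕ (g x ⊕ ∑ xs g))       ≡⟨ sym (S.+-assoc _ _ _) ⟩
      (f x ⊕ ∑ xs f) ⊕ (g x ⊕ ∑ xs g)       ∎

    ∑-⊗ˡ : ∀ (xs : List X) c f → ∑ xs (λ x → c ⊗ f x) ≡ c ⊗ ∑ xs f
    ∑-⊗ˡ []       c f = sym (S.zeroʳ c)
    ∑-⊗ˡ (x ∷ xs) c f = trans (cong ((c ⊗ f x) ⊕_) (∑-⊗ˡ xs c f)) (sym (S.distribˡ c _ _))

  ∑-concatMap : ∀ {X Y : Set} (g : X → List Y) (xs : List X) f →
                ∑ (concatMap g xs) f ≡ ∑ xs (λ x → ∑ (g x) f)
  ∑-concatMap g []       f = refl
  ∑-concatMap g (x ∷ xs) f = trans (∑-++ (g x) _ f) (cong (∑ (g x) f ⊕_) (∑-concatMap g xs f))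

  ∑-seqs-suc : ∀ t f → ∑ (seqs (suc t)) f ≡ ∑ (seqs t) (λ s → f (true ∷ s) ⊕ f (false ∷ s))
  ∑-seqs-suc t f = trans (∑-concatMap _ (seqs t) f)
                         (∑-cong (seqs t) λ s → cong (f (true ∷ s) ⊕_) (S.+-identityʳ _))

  ∑-seqs-+ : ∀ t m f → ∑ (seqs (t + m)) f ≡ ∑ (seqs t) (λ u → ∑ (seqs m) (λ v → f (u ++ v)))
  ∑-seqs-+ zero    m f = sym (S.+-identityʳ _)
  ∑-seqs-+ (suc t) m f = begin
    ∑ (seqs (suc (t + m))) f
      ≡⟨ ∑-seqs-suc (t + m) f ⟩
    ∑ (seqs (t + m)) (λ s → f (true ∷ s) ⊕ f (false ∷ s))
      ≡⟨ ∑-seqs-+ t m _ ⟩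
    ∑ (seqs t) (λ u → ∑ (seqs m) (λ v → f (true ∷ u ++ v) ⊕ f (false ∷ u ++ v)))
      ≡⟨ ∑-cong (seqs t) (λ u → ∑-⊕ (seqs m) _ _) ⟩
    ∑ (seqs t) (λ u → ∑ (seqs m) (λ v → f (true ∷ u ++ v)) ⊕ ∑ (seqs m) (λ v → f (false ∷ u ++ v)))
      ≡⟨ ∑-seqs-suc t _ ⟨
    ∑ (seqs (suc t)) (λ u → ∑ (seqs m) (λ v → f (u ++ v))) ∎

  ∑-seqs-∷ʳ : ∀ t f → ∑ (seqs (suc t)) f ≡ ∑ (seqs t) (λ s → f (s ∷ʳ true) ⊕ f (s ∷ʳ false))
  ∑-seqs-∷ʳ t f = begin
    ∑ (seqs (suc t)) f
      ≡⟨ cong (λ k → ∑ (seqs k) f) (+-comm 1 t) ⟩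
    ∑ (seqs (t + 1)) f
      ≡⟨ ∑-seqs-+ t 1 f ⟩
    ∑ (seqs t) (λ s → f (s ∷ʳ true) ⊕ (f (s ∷ʳ false) ⊕ 0#))
      ≡⟨ ∑-cong (seqs t) (λ s → cong (f (s ∷ʳ true) ⊕_) (S.+-identityʳ _)) ⟩
    ∑ (seqs t) (λ s → f (s ∷ʳ true) ⊕ f (s ∷ʳ false)) ∎

open ListSum +-*-isSemiring public
module ℤ∑ = ListSum ℤₚ.+-*-isSemiring

module _ {X : Set} where

  ∑-mono-≤ : ∀ (xs : List X) {f g} → (∀ x → f x ≤ g x) → ∑ xs f ≤ ∑ xs g
  ∑-mono-≤ []       f≤g = z≤n
  ∑-mono-≤ (x ∷ xs) f≤g = +-mono-≤ (f≤g x) (∑-mono-≤ xs f≤g)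

  ∑-≤-length : ∀ (xs : List X) {f} → (∀ x → f x ≤ 1) → ∑ xs f ≤ length xs
  ∑-≤-length []       f≤1 = z≤n
  ∑-≤-length (x ∷ xs) f≤1 = +-mono-≤ (f≤1 x) (∑-≤-length xs f≤1)

  ∑-<-length : ∀ {xs : List X} {f x₀} → (∀ x → f x ≤ 1) → x₀ ∈ xs → f x₀ ≡ 0 → ∑ xs f < length xs
  ∑-<-length {x ∷ xs} f≤1 (here refl) fx₀≡0 rewrite fx₀≡0 = s≤s (∑-≤-length xs f≤1)
  ∑-<-length {x ∷ xs} f≤1 (there x₀∈) fx₀≡0 = +-mono-≤-< (f≤1 x) (∑-<-length f≤1 x₀∈ fx₀≡0)

  length-filter : ∀ (p : X → Bool) xs →
                  length (filter (λ x → p x Bool.≟ true) xs) ≡ ∑ xs (λ x → 𝟙 (p x))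
  length-filter p []       = refl
  length-filter p (x ∷ xs) with p x
  ... | true  = cong suc (length-filter p xs)
  ... | false = length-filter p xs

  ∣∑∣≤∑∣∣ : ∀ (xs : List X) f → ℤ.∣ ℤ∑.∑ xs f ∣ ≤ ∑ xs (λ x → ℤ.∣ f x ∣)
  ∣∑∣≤∑∣∣ []       f = z≤n
  ∣∑∣≤∑∣∣ (x ∷ xs) f = ≤-trans (ℤₚ.∣i+j∣≤∣i∣+∣j∣ (f x) _) (+-monoʳ-≤ _ (∣∑∣≤∑∣∣ xs f))

  pos-∑ : ∀ (xs : List X) f → ℤ∑.∑ xs (λ x → + f x) ≡ + ∑ xs f
  pos-∑ []       f = refl
  pos-∑ (x ∷ xs) f = cong (ℤ._+_ (+ f x)) (pos-∑ xs f)

length≡∑1 : ∀ {X : Set} (xs : List X) → length xs ≡ ∑ xs (λ _ → 1)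
length≡∑1 []       = refl
length≡∑1 (x ∷ xs) = cong suc (length≡∑1 xs)

length-seqs : ∀ t → length (seqs t) ≡ 2 ^ t
length-seqs zero    = refl
length-seqs (suc t) = begin
  length (seqs (suc t))        ≡⟨ length≡∑1 (seqs (suc t)) ⟩
  ∑ (seqs (suc t)) (λ _ → 1)   ≡⟨ ∑-seqs-suc t _ ⟩
  ∑ (seqs t) (λ _ → 2 * 1)     ≡⟨ ∑-⊗ˡ (seqs t) 2 _ ⟩
  2 * ∑ (seqs t) (λ _ → 1)     ≡⟨ cong (2 *_) (trans (sym (length≡∑1 (seqs t))) (length-seqs t)) ⟩
  2 * 2 ^ t                    ∎
  where open ≡-Reasoning

heads∈seqs : ∀ t → replicate t true ∈ seqs t
heads∈seqs zero    = here refl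
heads∈seqs (suc t) = ∈-concatMap⁺ _ (Any.map (λ eq → here (cong (true ∷_) eq)) (heads∈seqs t))

toℚᵘ-/ : ∀ i d .{{_ : NonZero d}} → ℚ.toℚᵘ (i / d) ≃ (i ℚᵘ./ d)
toℚᵘ-/ i (suc d) = toℚᵘ-fromℚᵘ (mkℚᵘ i d)

/-cross : ∀ i j {d e} .{{_ : NonZero d}} .{{_ : NonZero e}} →
          i ℤ.* + e ≡ j ℤ.* + d → i / d ≡ j / e
/-cross i j {suc d} {suc e} eq = fromℚᵘ-cong {mkℚᵘ i d} {mkℚᵘ j e} (*≡* eq)

+-/ : ∀ i j d e .{{_ : NonZero d}} .{{_ : NonZero e}} →
      i / d ℚ.+ j / e ≡ ((i ℤ.* + e ℤ.+ j ℤ.* + d) / (d * e)) {{m*n≢0 d e}}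
+-/ i j d@(suc _) e@(suc _) = toℚᵘ-injective (begin
  ℚ.toℚᵘ (i / d ℚ.+ j / e)                        ≈⟨ toℚᵘ-homo-+ (i / d) (j / e) ⟩
  ℚ.toℚᵘ (i / d) ℚᵘ.+ ℚ.toℚᵘ (j / e)              ≈⟨ ℚᵘₚ.+-cong (toℚᵘ-/ i d) (toℚᵘ-/ j e) ⟩
  (i ℤ.* + e ℤ.+ j ℤ.* + d) ℚᵘ./ (d * e)          ≈⟨ toℚᵘ-/ _ (d * e) ⟨
  ℚ.toℚᵘ ((i ℤ.* + e ℤ.+ j ℤ.* + d) / (d * e))    ∎)
  where open ℚᵘₚ.≃-Reasoning

*-/ : ∀ i j d e .{{_ : NonZero d}} .{{_ : NonZero e}} →
      (i / d) ℚ.* (j / e) ≡ ((i ℤ.* j) / (d * e)) {{m*n≢0 d e}}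
*-/ i j d@(suc _) e@(suc _) = toℚᵘ-injective (begin
  ℚ.toℚᵘ ((i / d) ℚ.* (j / e))              ≈⟨ toℚᵘ-homo-* (i / d) (j / e) ⟩
  ℚ.toℚᵘ (i / d) ℚᵘ.* ℚ.toℚᵘ (j / e)        ≈⟨ ℚᵘₚ.*-cong (toℚᵘ-/ i d) (toℚᵘ-/ j e) ⟩
  (i ℤ.* j) ℚᵘ./ (d * e)                    ≈⟨ toℚᵘ-/ _ (d * e) ⟨
  ℚ.toℚᵘ ((i ℤ.* j) / (d * e))              ∎)
  where open ℚᵘₚ.≃-Reasoning

-‿/ : ∀ i d .{{_ : NonZero d}} → ℚ.- (i / d) ≡ (ℤ.- i) / d
-‿/ i d@(suc _) = toℚᵘ-injective (begin
  ℚ.toℚᵘ (ℚ.- (i / d))   ≈⟨ toℚᵘ-homo‿- (i / d) ⟩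
  ℚᵘ.- ℚ.toℚᵘ (i / d)    ≈⟨ ℚᵘₚ.-‿cong (toℚᵘ-/ i d) ⟩
  (ℤ.- i) ℚᵘ./ d         ≈⟨ toℚᵘ-/ _ d ⟨
  ℚ.toℚᵘ ((ℤ.- i) / d)   ∎)
  where open ℚᵘₚ.≃-Reasoning

∣-∣-/ : ∀ i d .{{_ : NonZero d}} → ℚ.∣ i / d ∣ ≡ + ℤ.∣ i ∣ / d
∣-∣-/ i d@(suc _) = toℚᵘ-injective (begin
  ℚ.toℚᵘ ℚ.∣ i / d ∣     ≈⟨ toℚᵘ-homo-∣-∣ (i / d) ⟩
  ℚᵘ.∣ ℚ.toℚᵘ (i / d) ∣  ≈⟨ ℚᵘₚ.∣-∣-cong (toℚᵘ-/ i d) ⟩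
  + ℤ.∣ i ∣ ℚᵘ./ d       ≈⟨ toℚᵘ-/ _ d ⟨
  ℚ.toℚᵘ (+ ℤ.∣ i ∣ / d) ∎)
  where open ℚᵘₚ.≃-Reasoning

+-/-halves : ∀ i j c x .{{c≢0 : NonZero c}} .{{_ : NonZero x}} →
             (i / (c * x)) {{m*n≢0 c x}} ℚ.+ (j / (2 * x)) {{m*n≢0 2 x}}
             ≡ ((+ 2 ℤ.* i ℤ.+ + c ℤ.* j) / (c * (2 * x))) {{m*n≢0 c (2 * x) {{c≢0}} {{m*n≢0 2 x}}}}
+-/-halves i j c@(suc _) x@(suc _) =
  trans (+-/ i j (c * x) (2 * x)) (/-cross (i ℤ.* + (2 * x) ℤ.+ j ℤ.* + (c * x)) (+ 2 ℤ.* i ℤ.+ + c ℤ.* j) cross)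
  where
  cross : (i ℤ.* + (2 * x) ℤ.+ j ℤ.* + (c * x)) ℤ.* + (c * (2 * x))
          ≡ (+ 2 ℤ.* i ℤ.+ + c ℤ.* j) ℤ.* + (c * x * (2 * x))
  cross = ring {+ c} {+ x} (ℤₚ.pos-* 2 x) (ℤₚ.pos-* c x) (ℤₚ.pos-* c (2 * x)) (ℤₚ.pos-* (c * x) (2 * x))
    where
    ring : ∀ {C X X₂ CX CX₂ CXX₂} →
           X₂ ≡ + 2 ℤ.* X → CX ≡ C ℤ.* X → CX₂ ≡ C ℤ.* X₂ → CXX₂ ≡ CX ℤ.* X₂ →
           (i ℤ.* X₂ ℤ.+ j ℤ.* CX) ℤ.* CX₂ ≡ (+ 2 ℤ.* i ℤ.+ C ℤ.* j) ℤ.* CXX₂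
    ring {C} {X} refl refl refl refl = solved i j C X
      where
      solved : ∀ i j C X → (i ℤ.* (+ 2 ℤ.* X) ℤ.+ j ℤ.* (C ℤ.* X)) ℤ.* (C ℤ.* (+ 2 ℤ.* X))
                           ≡ (+ 2 ℤ.* i ℤ.+ C ℤ.* j) ℤ.* (C ℤ.* X ℤ.* (+ 2 ℤ.* X))
      solved = solve-∀

half-< : ∀ k {y} → 2 * k ≤ y → 0 < y → k < y
half-< zero    _    0<y = 0<y
half-< (suc k) 2k≤y _   = <-≤-trans (m<m+n (suc k) z<s) 2k≤y

*2^-nonZero : ∀ c t .{{_ : NonZero c}} → NonZero (c * 2 ^ t)
*2^-nonZero c t {{c≢0}} = m*n≢0 c (2 ^ t) {{c≢0}} {{m^n≢0 2 t}}

+k/d<ε : ∀ (ε : ℚ) → 0ℚ ℚ.< ε → ∀ k d .{{_ : NonZero d}} → k * ↧ₙ ε < d → + k / d ℚ.< ε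
+k/d<ε (mkℚ +[1+ ν ] den _) _ k d@(suc _) k*den<d =
  toℚᵘ-cancel-< (ℚᵘₚ.<-respˡ-≃ (ℚᵘₚ.≃-sym (toℚᵘ-/ (+ k) d)) (*<* (begin-strict
    + k ℤ.* + suc den    ≡⟨ ℤₚ.pos-* k (suc den) ⟨
    + (k * suc den)      <⟨ ℤ.+<+ (<-≤-trans k*den<d (m≤m+n d (ν * d))) ⟩
    + (suc ν * d)        ≡⟨ ℤₚ.pos-* (suc ν) d ⟩
    +[1+ ν ] ℤ.* + d     ∎)))
  where open ℤₚ.≤-Reasoning
+k/d<ε (mkℚ (+ zero)   _ _) (ℚ.*<* (ℤ.+<+ ()))
+k/d<ε (mkℚ -[1+ _ ]   _ _) (ℚ.*<* ())

module _ (a : ℕ → ℚ) (L : ℚ) (c : ℕ) .{{_ : NonZero c}} (e : ℕ → ℤ) where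

  ⟶-if-dyadic-error : (∀ t → a (suc t) ℚ.- L ≡ (e t / (c * 2 ^ t)) {{*2^-nonZero c t}}) →
                      (∀ B → ∃[ N ] (∀ t → N ≤ t → B * ℤ.∣ e t ∣ ≤ 2 ^ t)) →
                      a ⟶ L
  ⟶-if-dyadic-error a-L≡ small ε 0<ε = suc N , close
    where
    N = proj₁ (small (2 * ↧ₙ ε))

    2e≤2^t : ∀ t → N ≤ t → 2 * (ℤ.∣ e t ∣ * ↧ₙ ε) ≤ 2 ^ t
    2e≤2^t t N≤t = ≤-trans (≤-reflexive (cong (2 *_) (*-comm ℤ.∣ e t ∣ (↧ₙ ε))))
                           (≤-trans (≤-reflexive (sym (*-assoc 2 (↧ₙ ε) ℤ.∣ e t ∣)))
                                    (proj₂ (small (2 * ↧ₙ ε)) t N≤t))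

    close : ∀ M → suc N ≤ M → ℚ.∣ a M ℚ.- L ∣ ℚ.< ε
    close (suc t) (s≤s N≤t) = begin-strict
      ℚ.∣ a (suc t) ℚ.- L ∣                        ≡⟨ cong ℚ.∣_∣ (a-L≡ t) ⟩
      ℚ.∣ (e t / (c * 2 ^ t)) {{c2^t≢0}} ∣         ≡⟨ ∣-∣-/ (e t) (c * 2 ^ t) {{c2^t≢0}} ⟩
      (+ ℤ.∣ e t ∣ / (c * 2 ^ t)) {{c2^t≢0}}       <⟨ +k/d<ε ε 0<ε ℤ.∣ e t ∣ (c * 2 ^ t) {{c2^t≢0}} e<c2^t ⟩
      ε                                            ∎
      where
      open ℚₚ.≤-Reasoning
      c2^t≢0 = *2^-nonZero c t
      e<c2^t : ℤ.∣ e t ∣ * ↧ₙ ε < c * 2 ^ t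
      e<c2^t = <-≤-trans (half-< _ (2e≤2^t t N≤t) (m^n>0 2 t)) (m≤n*m _ c)

[p+q]-r≡[p-r]+q : ∀ p q r → (p ℚ.+ q) ℚ.- r ≡ (p ℚ.- r) ℚ.+ q
[p+q]-r≡[p-r]+q p q r = begin
  (p ℚ.+ q) ℚ.+ ℚ.- r     ≡⟨ ℚₚ.+-assoc p q (ℚ.- r) ⟩
  p ℚ.+ (q ℚ.+ ℚ.- r)     ≡⟨ cong (p ℚ.+_) (ℚₚ.+-comm q (ℚ.- r)) ⟩
  p ℚ.+ (ℚ.- r ℚ.+ q)     ≡⟨ ℚₚ.+-assoc p (ℚ.- r) q ⟨
  (p ℚ.+ ℚ.- r) ℚ.+ q     ∎
  where open ≡-Reasoning

module _ (a : ℕ → ℚ) (L : ℚ) (c : ℕ) .{{c≢0 : NonZero c}} (h e : ℕ → ℤ) where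

  dyadic-error : a 1 ℚ.- L ≡ (e 0 / (c * 2 ^ 0)) {{*2^-nonZero c 0}} →
                 (∀ t → a (suc (suc t)) ≡ a (suc t) ℚ.+ (h (suc t) / 2 ^ suc t) {{m^n≢0 2 (suc t)}}) →
                 (∀ t → + 2 ℤ.* e t ℤ.+ + c ℤ.* h (suc t) ≡ e (suc t)) →
                 ∀ t → a (suc t) ℚ.- L ≡ (e t / (c * 2 ^ t)) {{*2^-nonZero c t}}
  dyadic-error base step rec zero    = base
  dyadic-error base step rec (suc t) = begin
    a (suc (suc t)) ℚ.- L                                   ≡⟨ cong (ℚ._- L) (step t) ⟩
    (a (suc t) ℚ.+ H) ℚ.- L                                 ≡⟨ [p+q]-r≡[p-r]+q (a (suc t)) H L ⟩
    (a (suc t) ℚ.- L) ℚ.+ H                                 ≡⟨ cong (ℚ._+ H) (dyadic-error base step rec t) ⟩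
    (e t / (c * 2 ^ t)) {{*2^-nonZero c t}} ℚ.+ H           ≡⟨ +-/-halves (e t) (h (suc t)) c (2 ^ t) {{c≢0}} {{m^n≢0 2 t}} ⟩
    (+ 2 ℤ.* e t ℤ.+ + c ℤ.* h (suc t)) / (c * 2 ^ suc t)  ≡⟨ cong (λ i → i / (c * 2 ^ suc t)) (rec t) ⟩
    e (suc t) / (c * 2 ^ suc t)                             ∎
    where
    open ≡-Reasoning
    instance _ = *2^-nonZero c (suc t)
    H = (h (suc t) / 2 ^ suc t) {{m^n≢0 2 (suc t)}}

-- Geometric decay beats polynomial growth

bernoulli : ∀ L j → L ^ j * (L + j) ≤ L * suc L ^ j
bernoulli L zero    = ≤-reflexive (trans (+-identityʳ (L + 0)) (trans (+-identityʳ L) (sym (*-identityʳ L))))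
bernoulli L (suc j) = begin
  L ^ suc j * (L + suc j)                  ≡⟨ expand L (L ^ j) j ⟩
  L * (L ^ j * (L + j)) + L ^ j * L        ≤⟨ +-monoʳ-≤ _ (*-monoʳ-≤ (L ^ j) (m≤m+n L j)) ⟩
  L * (L ^ j * (L + j)) + L ^ j * (L + j)  ≡⟨ +-comm (L * _) _ ⟩
  suc L * (L ^ j * (L + j))                ≤⟨ *-monoʳ-≤ (suc L) (bernoulli L j) ⟩
  suc L * (L * suc L ^ j)                  ≡⟨ x∙yz≈y∙xz (suc L) L (suc L ^ j) ⟩
  L * suc L ^ suc j                        ∎
  where
  open ≤-Reasoning
  expand : ∀ L X j → L * X * (L + suc j) ≡ L * (X * (L + j)) + X * L
  expand = ℕ-Solver.solve-∀

4*L^3L≤[1+L]^3L : ∀ L .{{_ : NonZero L}} → 4 * L ^ (3 * L) ≤ suc L ^ (3 * L)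
4*L^3L≤[1+L]^3L L = *-cancelˡ-≤ L (begin
  L * (4 * L ^ (3 * L))         ≡⟨ rearrange L (L ^ (3 * L)) ⟩
  L ^ (3 * L) * (L + 3 * L)     ≤⟨ bernoulli L (3 * L) ⟩
  L * suc L ^ (3 * L)           ∎)
  where
  open ≤-Reasoning
  rearrange : ∀ L X → L * (4 * X) ≡ X * (L + 3 * L)
  rearrange = ℕ-Solver.solve-∀

suc≤2^ : ∀ h → suc h ≤ 2 ^ h
suc≤2^ zero    = s≤s z≤n
suc≤2^ (suc h) = ≤-trans (+-mono-≤ (m^n>0 2 h) (suc≤2^ h)) (≤-reflexive (cong (_+_ (2 ^ h)) (sym (+-identityʳ (2 ^ h)))))

pred[2^m]≢0 : ∀ m .{{_ : NonZero m}} → NonZero (pred (2 ^ m))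
pred[2^m]≢0 (suc m) = ℕ.>-nonZero (pred-mono-≤ (*-monoʳ-≤ 2 (m^n>0 2 m)))

module GeometricDecay (r : ℕ → ℕ) (m : ℕ) .{{m≢0 : NonZero m}}
                      (r≤2^ : ∀ t → r t ≤ 2 ^ t)
                      (contracts : ∀ t → r (t + m) ≤ pred (2 ^ m) * r t) where

  private
    L = pred (2 ^ m)
    instance
      L≢0 : NonZero L
      L≢0 = pred[2^m]≢0 m
    P = m * (3 * L)
    instance
      P≢0 : NonZero P
      P≢0 = m*n≢0 m (3 * L) {{m≢0}} {{m*n≢0 3 L}}

  iterate : ∀ j t → r (t + j * m) ≤ L ^ j * r t
  iterate zero    t = ≤-reflexive (trans (cong r (+-identityʳ t)) (sym (+-identityʳ (r t))))
  iterate (suc j) t = begin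
    r (t + suc j * m)      ≡⟨ cong r (shift t j m) ⟩
    r (t + j * m + m)      ≤⟨ contracts (t + j * m) ⟩
    L * r (t + j * m)      ≤⟨ *-monoʳ-≤ L (iterate j t) ⟩
    L * (L ^ j * r t)      ≡⟨ *-assoc L (L ^ j) (r t) ⟨
    L ^ suc j * r t        ∎
    where
    open ≤-Reasoning
    shift : ∀ t j m → t + suc j * m ≡ t + j * m + m
    shift = ℕ-Solver.solve-∀

  -- Bernoulli gives (L + 1)^{3L} ≥ 4L^{3L}: every 3L blocks of m tosses at least quarter r t / 2ᵗ.
  quarter : ∀ t → 4 * r (t + P) ≤ 2 ^ P * r t
  quarter t = begin
    4 * r (t + P)                  ≡⟨ cong (λ k → 4 * r (t + k)) (*-comm m (3 * L)) ⟩
    4 * r (t + 3 * L * m)          ≤⟨ *-monoʳ-≤ 4 (iterate (3 * L) t) ⟩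
    4 * (L ^ (3 * L) * r t)        ≡⟨ *-assoc 4 (L ^ (3 * L)) (r t) ⟨
    4 * L ^ (3 * L) * r t          ≤⟨ *-monoˡ-≤ (r t) (4*L^3L≤[1+L]^3L L) ⟩
    suc L ^ (3 * L) * r t          ≡⟨ cong (λ k → k ^ (3 * L) * r t) (suc-pred (2 ^ m) {{m^n≢0 2 m}}) ⟩
    (2 ^ m) ^ (3 * L) * r t        ≡⟨ cong (_* r t) (^-*-assoc 2 m (3 * L)) ⟩
    2 ^ P * r t                    ∎
    where open ≤-Reasoning

  quarter-iterate : ∀ h i → 2 ^ h * 2 ^ h * r (h * P + i) ≤ 2 ^ (h * P + i)
  quarter-iterate zero    i = ≤-trans (≤-reflexive (+-identityʳ (r i))) (r≤2^ i)
  quarter-iterate (suc h) i = begin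
    2 ^ suc h * 2 ^ suc h * r (suc h * P + i)   ≡⟨ cong (λ k → 2 ^ suc h * 2 ^ suc h * r k) (shift h P i) ⟩
    2 ^ suc h * 2 ^ suc h * r (x + P)           ≡⟨ regroup (2 ^ h) (r (x + P)) ⟩
    2 ^ h * 2 ^ h * (4 * r (x + P))             ≤⟨ *-monoʳ-≤ (2 ^ h * 2 ^ h) (quarter x) ⟩
    2 ^ h * 2 ^ h * (2 ^ P * r x)               ≡⟨ x∙yz≈y∙xz (2 ^ h * 2 ^ h) (2 ^ P) (r x) ⟩
    2 ^ P * (2 ^ h * 2 ^ h * r x)               ≤⟨ *-monoʳ-≤ (2 ^ P) (quarter-iterate h i) ⟩
    2 ^ P * 2 ^ x                               ≡⟨ trans (^-distribˡ-+-* 2 x P) (*-comm (2 ^ x) (2 ^ P)) ⟨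
    2 ^ (x + P)                                 ≡⟨ cong (2 ^_) (shift h P i) ⟨
    2 ^ (suc h * P + i)                         ∎
    where
    open ≤-Reasoning
    x = h * P + i
    shift : ∀ h P i → suc h * P + i ≡ h * P + i + P
    shift = ℕ-Solver.solve-∀
    regroup : ∀ X R → 2 * X * (2 * X) * R ≡ X * X * (4 * R)
    regroup = ℕ-Solver.solve-∀

  eventually-small : ∀ B → ∃[ N ] (∀ t → N ≤ t → B * suc t * r t ≤ 2 ^ t)
  eventually-small B = B * P * P , small
    where
    small : ∀ t → B * P * P ≤ t → B * suc t * r t ≤ 2 ^ t
    small t BPP≤t = begin
      B * suc t * r t                 ≤⟨ *-monoˡ-≤ (r t) (*-monoʳ-≤ B 1+t≤[1+h]P) ⟩
      B * (suc h * P) * r t           ≡⟨ regroup B h P (r t) ⟩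
      B * P * suc h * r t             ≤⟨ *-monoˡ-≤ (r t) (*-mono-≤ (≤-trans BP≤h (<⇒≤ (suc≤2^ h))) (suc≤2^ h)) ⟩
      2 ^ h * 2 ^ h * r t             ≡⟨ cong (λ k → 2 ^ h * 2 ^ h * r k) t≡hP+i ⟩
      2 ^ h * 2 ^ h * r (h * P + i)   ≤⟨ quarter-iterate h i ⟩
      2 ^ (h * P + i)                 ≡⟨ cong (2 ^_) t≡hP+i ⟨
      2 ^ t                           ∎
      where
      open ≤-Reasoning
      h = t DivMod./ P
      i = t DivMod.% P
      t≡hP+i : t ≡ h * P + i
      t≡hP+i = trans (DivMod.m≡m%n+[m/n]*n t P) (+-comm i (h * P))
      BP≤h : B * P ≤ h
      BP≤h = subst (_≤ h) (DivMod.m*n/n≡m (B * P) P) (DivMod./-monoˡ-≤ P BPP≤t)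
      1+t≤[1+h]P : suc t ≤ suc h * P
      1+t≤[1+h]P = begin
        suc t            ≡⟨ cong suc t≡hP+i ⟩
        suc (h * P + i)  ≡⟨ +-suc (h * P) i ⟨
        h * P + suc i    ≤⟨ +-monoʳ-≤ (h * P) (DivMod.m%n<n t P) ⟩
        h * P + P        ≡⟨ +-comm (h * P) P ⟩
        suc h * P        ∎
      regroup : ∀ B h P R → B * (suc h * P) * R ≡ B * P * suc h * R
      regroup = ℕ-Solver.solve-∀

move : ℤ → Bool → ℤ
move p d = if d then p ℤ.+ + 1 else p ℤ.- + 1

moveWalker : State → Bool → State
moveWalker σ d = st (occupied σ) (move (walker σ) d)

sites : State → ℕ
sites σ = length (occupied σ)

runFrom : State → List Bool → State
runFrom = foldl step

step-∈ : ∀ σ d → move (walker σ) d ∈ occupied σ → step σ d ≡ moveWalker σ d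
step-∈ σ d q∈ with move (walker σ) d ∈? occupied σ
... | yes _  = refl
... | no q∉ = ⊥-elim (q∉ q∈)

step-∉ : ∀ σ d → move (walker σ) d ∉ occupied σ → step σ d ≡ st (move (walker σ) d ∷ occupied σ) 0ℤ
step-∉ σ d q∉ with move (walker σ) d ∈? occupied σ
... | yes q∈ = ⊥-elim (q∉ q∈)
... | no _   = refl

step-sites : ∀ σ d → sites (step σ d) ≡ sites σ ⊎ (sites (step σ d) ≡ suc (sites σ) × walker (step σ d) ≡ 0ℤ)
step-sites σ d with move (walker σ) d ∈? occupied σ
... | yes _ = inj₁ refl
... | no _  = inj₂ (refl , refl)

sites-≤-step : ∀ σ d → sites σ ≤ sites (step σ d)
sites-≤-step σ d with step-sites σ d
... | inj₁ eq       = ≤-reflexive (sym eq)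
... | inj₂ (eq , _) = ≤-trans (n≤1+n _) (≤-reflexive (sym eq))

sites-≤-runFrom : ∀ σ s → sites σ ≤ sites (runFrom σ s)
sites-≤-runFrom σ []      = ≤-refl
sites-≤-runFrom σ (d ∷ s) = ≤-trans (sites-≤-step σ d) (sites-≤-runFrom (step σ d) s)

run-++ : ∀ s u → run (s ++ u) ≡ runFrom (run s) u
run-++ = Listₚ.foldl-++ step initial

run-∷ʳ : ∀ s d → run (s ∷ʳ d) ≡ step (run s) d
run-∷ʳ s d = Listₚ.foldl-∷ʳ step initial d s

size-≤-++ : ∀ s u → size s ≤ size (s ++ u)
size-≤-++ s u = subst (λ σ → size s ≤ sites σ) (sym (run-++ s u)) (sites-≤-runFrom (run s) u)

take-suc-prefix : ∀ {A : Set} k (xs : List A) → ∃[ ys ] take (suc k) xs ≡ take k xs ++ ys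
take-suc-prefix zero    xs       = take 1 xs , refl
take-suc-prefix (suc k) []       = [] , refl
take-suc-prefix (suc k) (x ∷ xs) = let ys , eq = take-suc-prefix k xs in ys , cong (x ∷_) eq

take-length-++ : ∀ {A : Set} (xs ys : List A) → take (length xs) (xs ++ ys) ≡ xs
take-length-++ []       ys = refl
take-length-++ (x ∷ xs) ys = cong (x ∷_) (take-length-++ xs ys)

any-∷ʳ : ∀ {A : Set} (P : A → Bool) xs x → any P (xs ∷ʳ x) ≡ any P xs ∨ P x
any-∷ʳ P []       x = Boolₚ.∨-identityʳ (P x)
any-∷ʳ P (y ∷ xs) x = trans (cong (P y ∨_) (any-∷ʳ P xs x)) (sym (Boolₚ.∨-assoc (P y) _ _))

∨-absorbs : ∀ {a b} → (T a → T b) → a ∨ b ≡ b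
∨-absorbs {true}  {true}  _   = refl
∨-absorbs {true}  {false} a⇒b = ⊥-elim (a⇒b _)
∨-absorbs {false}         _   = refl

any-upTo-mono : ∀ (P : ℕ → Bool) → (∀ k → T (P k) → T (P (suc k))) → ∀ L → any P (upTo (suc L)) ≡ P L
any-upTo-mono P mono zero    = Boolₚ.∨-identityʳ (P 0)
any-upTo-mono P mono (suc L) = begin
  any P (upTo (suc (suc L)))         ≡⟨ cong (any P) (Listₚ.upTo-∷ʳ (suc L)) ⟨
  any P (upTo (suc L) ∷ʳ suc L)      ≡⟨ any-∷ʳ P (upTo (suc L)) (suc L) ⟩
  any P (upTo (suc L)) ∨ P (suc L)   ≡⟨ cong (_∨ P (suc L)) (any-upTo-mono P mono L) ⟩
  P L ∨ P (suc L)                    ≡⟨ ∨-absorbs (mono L) ⟩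
  P (suc L)                          ∎
  where open ≡-Reasoning

≤ᵇ-mono : ∀ n {x y} → T (n ≤ᵇ x) → x ≤ y → T (n ≤ᵇ y)
≤ᵇ-mono n {x} n≤ᵇx x≤y = ≤⇒≤ᵇ (≤-trans (≤ᵇ⇒≤ n x n≤ᵇx) x≤y)

firstHit-∷ʳ : ∀ n s d → firstHit n (s ∷ʳ d) ≡ (n ≤ᵇ size (s ∷ʳ d)) ∧ not (n ≤ᵇ size s)
firstHit-∷ʳ n s d = cong (λ b → (n ≤ᵇ size (s ∷ʳ d)) ∧ not b) (begin
  any P (upTo (length (s ∷ʳ d)))   ≡⟨ cong (any P ∘ upTo) (trans (Listₚ.length-++ s) (+-comm (length s) 1)) ⟩
  any P (upTo (suc (length s)))    ≡⟨ any-upTo-mono P prefix-mono (length s) ⟩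
  P (length s)                     ≡⟨ cong (λ u → n ≤ᵇ size u) (take-length-++ s (d ∷ [])) ⟩
  n ≤ᵇ size s                      ∎)
  where
  open ≡-Reasoning
  P : ℕ → Bool
  P k = n ≤ᵇ size (take k (s ∷ʳ d))
  prefix-mono : ∀ k → T (P k) → T (P (suc k))
  prefix-mono k Pk with take-suc-prefix k (s ∷ʳ d)
  ... | ys , eq = ≤ᵇ-mono n Pk (subst (λ u → size (take k (s ∷ʳ d)) ≤ size u) (sym eq) (size-≤-++ (take k (s ∷ʳ d)) ys))

-- The potential

open +-*-Solver using (Polynomial; op; con; var; _:^_; :-_; [+]; [*]; ⟦_⟧; _:+_; _:-_; _:*_; _:=_; solve)

signum : ℤ → ℤ
signum (+ zero)  = 0ℤ
signum +[1+ _ ]  = 1ℤ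
signum -[1+ _ ]  = -1ℤ

balance : List ℤ → ℤ
balance occ = ℤ∑.∑ occ signum

-- Φₙ in the ring solver's syntax, so that the identities about it below are checked by solve.
Potential : ∀ {m} → Polynomial m → Polynomial m → Polynomial m → Polynomial m → Polynomial m
Potential N K D P =
  N :* (N :* N :* N :- N :- (K :* K :* K :- K))
  :- con (+ 3) :* K :* (N :- K) :* D :* D
  :+ con (+ 12) :* P :* (K :* D :- (N :- con 1ℤ) :* P)

Potential₄ : Polynomial 4
Potential₄ = Potential (var 0F) (var 1F) (var 2F) (var 3F)

potential : ℤ → ℤ → ℤ → ℤ → ℤ
potential N K D P = ⟦ Potential₄ ⟧ (N ∷ K ∷ D ∷ P ∷ [])

Φ : ℕ → State → ℤ
Φ n σ = potential (+ n) (+ sites σ) (balance (occupied σ)) (walker σ)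

potential-drift : ∀ N K D P → potential N K D (P ℤ.+ 1ℤ) ℤ.+ potential N K D (P ℤ.- 1ℤ)
                              ≡ + 2 ℤ.* potential N K D P ℤ.- + 24 ℤ.* (N ℤ.- 1ℤ)
potential-drift = solve 4 (λ N K D P →
  Potential N K D (P :+ con 1ℤ) :+ Potential N K D (P :- con 1ℤ)
  := con (+ 2) :* Potential N K D P :- con (+ 24) :* (N :- con 1ℤ)) refl

potential-exit-right : ∀ N A B → potential N (+ 2 ℤ.+ A ℤ.+ B) (1ℤ ℤ.+ (B ℤ.- A)) 0ℤ
                                 ≡ potential N (1ℤ ℤ.+ A ℤ.+ B) (B ℤ.- A) (1ℤ ℤ.+ B)
potential-exit-right = solve 3 (λ N A B →
  Potential N (con (+ 2) :+ A :+ B) (con 1ℤ :+ (B :- A)) (con 0ℤ)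
  := Potential N (con 1ℤ :+ A :+ B) (B :- A) (con 1ℤ :+ B)) refl

potential-exit-left : ∀ N A B → potential N (+ 2 ℤ.+ A ℤ.+ B) (-1ℤ ℤ.+ (B ℤ.- A)) 0ℤ
                                ≡ potential N (1ℤ ℤ.+ A ℤ.+ B) (B ℤ.- A) (ℤ.- (1ℤ ℤ.+ A))
potential-exit-left = solve 3 (λ N A B →
  Potential N (con (+ 2) :+ A :+ B) (con -1ℤ :+ (B :- A)) (con 0ℤ)
  := Potential N (con 1ℤ :+ A :+ B) (B :- A) (:- (con 1ℤ :+ A))) refl

potential-final : ∀ N D → potential N N D 0ℤ ≡ 0ℤ
potential-final = solve 2 (λ N D → Potential N N D (con 0ℤ) := con 0ℤ) refl

potential-initial : ∀ N → + 12 ℤ.* potential N 1ℤ 0ℤ 0ℤ ≡ (N ℤ.* N ℤ.* N ℤ.+ N ℤ.* N) ℤ.* (+ 12 ℤ.* (N ℤ.- 1ℤ))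
potential-initial = solve 1 (λ N →
  con (+ 12) :* Potential N (con 1ℤ) (con 0ℤ) (con 0ℤ)
  := (N :* N :* N :+ N :* N) :* (con (+ 12) :* (N :- con 1ℤ))) refl

magnitude : ∀ {m} → Polynomial m → ℕ → ℕ
magnitude (op [+] p q) M = magnitude p M + magnitude q M
magnitude (op [*] p q) M = magnitude p M * magnitude q M
magnitude (con c)      M = ℤ.∣ c ∣
magnitude (var x)      M = M
magnitude (p :^ k)     M = magnitude p M ^ k
magnitude (:- p)       M = magnitude p M

∣⟦⟧∣≤magnitude : ∀ {m} (p : Polynomial m) {M} (ρ : Vec ℤ m) → (∀ i → ℤ.∣ lookup ρ i ∣ ≤ M) →
                 ℤ.∣ ⟦ p ⟧ ρ ∣ ≤ magnitude p M
∣⟦⟧∣≤magnitude (op [+] p q) ρ ρ≤M = ≤-trans (ℤₚ.∣i+j∣≤∣i∣+∣j∣ (⟦ p ⟧ ρ) (⟦ q ⟧ ρ))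
                                           (+-mono-≤ (∣⟦⟧∣≤magnitude p ρ ρ≤M) (∣⟦⟧∣≤magnitude q ρ ρ≤M))
∣⟦⟧∣≤magnitude (op [*] p q) ρ ρ≤M = ≤-trans (≤-reflexive (ℤₚ.abs-* (⟦ p ⟧ ρ) (⟦ q ⟧ ρ)))
                                           (*-mono-≤ (∣⟦⟧∣≤magnitude p ρ ρ≤M) (∣⟦⟧∣≤magnitude q ρ ρ≤M))
∣⟦⟧∣≤magnitude (con c)      ρ ρ≤M = ≤-refl
∣⟦⟧∣≤magnitude (var x)      ρ ρ≤M = ρ≤M x
∣⟦⟧∣≤magnitude (p :^ k) {M} ρ ρ≤M = ∣^∣≤ k
  where
  ∣^∣≤ : ∀ k → ℤ.∣ ⟦ p :^ k ⟧ ρ ∣ ≤ magnitude p M ^ k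
  ∣^∣≤ zero    = ≤-refl
  ∣^∣≤ (suc k) = ≤-trans (≤-reflexive (ℤₚ.abs-* (⟦ p ⟧ ρ) (⟦ p :^ k ⟧ ρ)))
                         (*-mono-≤ (∣⟦⟧∣≤magnitude p ρ ρ≤M) (∣^∣≤ k))
∣⟦⟧∣≤magnitude (:- p)       ρ ρ≤M = ≤-trans (≤-reflexive (ℤₚ.∣-i∣≡∣i∣ (⟦ p ⟧ ρ))) (∣⟦⟧∣≤magnitude p ρ ρ≤M)

potential-bounded : ∀ {M} N K D P → ℤ.∣ N ∣ ≤ M → ℤ.∣ K ∣ ≤ M → ℤ.∣ D ∣ ≤ M → ℤ.∣ P ∣ ≤ M →
                    ℤ.∣ potential N K D P ∣ ≤ magnitude Potential₄ M
potential-bounded N K D P N≤M K≤M D≤M P≤M =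
  ∣⟦⟧∣≤magnitude Potential₄ (N ∷ K ∷ D ∷ P ∷ []) λ where
    0F → N≤M
    1F → K≤M
    2F → D≤M
    3F → P≤M

Φ-drift : ∀ n σ → Φ n (moveWalker σ true) ℤ.+ Φ n (moveWalker σ false) ≡ + 2 ℤ.* Φ n σ ℤ.- + 24 ℤ.* (+ n ℤ.- 1ℤ)
Φ-drift n σ = potential-drift (+ n) (+ sites σ) (balance (occupied σ)) (walker σ)

Φ-final : ∀ n σ → sites σ ≡ n → walker σ ≡ 0ℤ → Φ n σ ≡ 0ℤ
Φ-final n σ refl w≡0 = trans (cong (potential (+ n) (+ n) (balance (occupied σ))) w≡0) (potential-final (+ n) _)

-- Interval configurations

site : ℕ → ℕ → ℤ
site a v = + v ℤ.- + a

site-injective : ∀ a {v w} → site a v ≡ site a w → v ≡ w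
site-injective a {v} {w} eq = ℤₚ.+-injective (begin
  + v                  ≡⟨ ring (+ v) (+ a) ⟩
  site a v ℤ.+ + a     ≡⟨ cong (ℤ._+ + a) eq ⟩
  site a w ℤ.+ + a     ≡⟨ ring (+ w) (+ a) ⟨
  + w                  ∎)
  where
  open ≡-Reasoning
  ring : ∀ V A → V ≡ (V ℤ.- A) ℤ.+ A
  ring = solve-∀

site-suc : ∀ a v → site a v ℤ.+ 1ℤ ≡ site a (suc v)
site-suc a v = ring (+ v) (+ a)
  where ring : ∀ V A → (V ℤ.- A) ℤ.+ 1ℤ ≡ (1ℤ ℤ.+ V) ℤ.- A
        ring = solve-∀

site-pred : ∀ a v → site a (suc v) ℤ.- 1ℤ ≡ site a v
site-pred a v = ring (+ v) (+ a)
  where ring : ∀ V A → ((1ℤ ℤ.+ V) ℤ.- A) ℤ.- 1ℤ ≡ V ℤ.- A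
        ring = solve-∀

site-shift : ∀ a v → site a v ≡ site (suc a) (suc v)
site-shift a v = ring (+ v) (+ a)
  where ring : ∀ V A → V ℤ.- A ≡ (1ℤ ℤ.+ V) ℤ.- (1ℤ ℤ.+ A)
        ring = solve-∀

site-right-end : ∀ a b → site a (suc (a + b)) ≡ 1ℤ ℤ.+ + b
site-right-end a b = ring (+ a) (+ b)
  where ring : ∀ A B → (1ℤ ℤ.+ (A ℤ.+ B)) ℤ.- A ≡ 1ℤ ℤ.+ B
        ring = solve-∀

site-left-end : ∀ a → site (suc a) 0 ≡ ℤ.- (1ℤ ℤ.+ + a)
site-left-end a = ℤₚ.+-identityˡ (ℤ.- + suc a)

-- The occupied sites are exactly -a, …, b, each listed once (by sites≡); the walker is on one of them.
record Interval (a b u : ℕ) (σ : State) : Set where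
  field
    u≤a+b    : u ≤ a + b
    sites≡   : sites σ ≡ suc (a + b)
    balance≡ : balance (occupied σ) ≡ + b ℤ.- + a
    walker≡  : walker σ ≡ site a u
    ∈⇒site   : ∀ {x} → x ∈ occupied σ → ∃[ v ] v ≤ a + b × x ≡ site a v
    site∈    : ∀ {v} → v ≤ a + b → site a v ∈ occupied σ

open Interval

initial-interval : Interval 0 0 0 initial
initial-interval = record
  { u≤a+b    = z≤n
  ; sites≡   = refl
  ; balance≡ = refl
  ; walker≡  = refl
  ; ∈⇒site   = λ { (here refl) → 0 , z≤n , refl }
  ; site∈    = λ { z≤n → here refl }
  }

module _ {a b : ℕ} {σ : State} where

  right-of-interval : ∀ {u} → Interval a b u σ → site a (suc (a + b)) ∉ occupied σ
  right-of-interval I q∈ with ∈⇒site I q∈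
  ... | v , v≤a+b , eq = 1+n≰n (subst (_≤ a + b) (sym (site-injective a eq)) v≤a+b)

  left-of-interval : ∀ {u} → Interval a b u σ → site (suc a) 0 ∉ occupied σ
  left-of-interval I q∈ with ∈⇒site I q∈
  ... | v , _ , eq with site-injective (suc a) {0} {suc v} (trans eq (site-shift a v))
  ... | ()

  relocate : ∀ {u u′ p} → Interval a b u σ → u′ ≤ a + b → p ≡ site a u′ → Interval a b u′ (st (occupied σ) p)
  relocate I u′≤a+b p≡ = record
    { u≤a+b    = u′≤a+b
    ; sites≡   = sites≡ I
    ; balance≡ = balance≡ I
    ; walker≡  = p≡
    ; ∈⇒site   = ∈⇒site I
    ; site∈    = site∈ I
    }

  right-inside : ∀ {u} → Interval a b u σ → u < a + b →
                 step σ true ≡ moveWalker σ true × Interval a b (suc u) (moveWalker σ true)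
  right-inside {u} I u<a+b = step-∈ σ true q∈ , relocate I u<a+b q≡
    where
    q≡ : move (walker σ) true ≡ site a (suc u)
    q≡ = trans (cong (ℤ._+ 1ℤ) (walker≡ I)) (site-suc a u)
    q∈ = subst (_∈ occupied σ) (sym q≡) (site∈ I u<a+b)

  left-inside : ∀ {u} → Interval a b (suc u) σ →
                step σ false ≡ moveWalker σ false × Interval a b u (moveWalker σ false)
  left-inside {u} I = step-∈ σ false q∈ , relocate I u≤a+b′ q≡
    where
    u≤a+b′ = <⇒≤ (u≤a+b I)
    q≡ : move (walker σ) false ≡ site a u
    q≡ = trans (cong (ℤ._- 1ℤ) (walker≡ I)) (site-pred a u)
    q∈ = subst (_∈ occupied σ) (sym q≡) (site∈ I u≤a+b′)

  right-exit-site : Interval a b (a + b) σ → move (walker σ) true ≡ site a (suc (a + b))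
  right-exit-site I = trans (cong (ℤ._+ 1ℤ) (walker≡ I)) (site-suc a (a + b))

  left-exit-site : Interval a b 0 σ → move (walker σ) false ≡ site (suc a) 0
  left-exit-site I = trans (cong (ℤ._- 1ℤ) (walker≡ I)) (ring (+ a))
    where ring : ∀ A → (0ℤ ℤ.- A) ℤ.- 1ℤ ≡ 0ℤ ℤ.- (1ℤ ℤ.+ A)
          ring = solve-∀

  right-exit : Interval a b (a + b) σ →
               step σ true ≡ st (+[1+ b ] ∷ occupied σ) 0ℤ × Interval a (suc b) a (st (+[1+ b ] ∷ occupied σ) 0ℤ)
  right-exit I = step≡ , record
    { u≤a+b    = m≤m+n a (suc b)
    ; sites≡   = cong suc (trans (sites≡ I) (sym (+-suc a b)))
    ; balance≡ = trans (cong (ℤ._+_ 1ℤ) (balance≡ I)) (ring (+ a) (+ b))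
    ; walker≡  = sym (ℤₚ.+-inverseʳ (+ a))
    ; ∈⇒site   = λ where
        (here refl)  → suc (a + b) , ≤-reflexive (sym (+-suc a b)) , sym (site-right-end a b)
        (there x∈)   → let v , v≤a+b , eq = ∈⇒site I x∈ in v , ≤-trans v≤a+b (+-monoʳ-≤ a (n≤1+n b)) , eq
    ; site∈    = site∈′
    }
    where
    ring : ∀ A B → 1ℤ ℤ.+ (B ℤ.- A) ≡ (1ℤ ℤ.+ B) ℤ.- A
    ring = solve-∀
    q≡ : move (walker σ) true ≡ +[1+ b ]
    q≡ = trans (right-exit-site I) (site-right-end a b)
    step≡ : step σ true ≡ st (+[1+ b ] ∷ occupied σ) 0ℤ
    step≡ = trans (step-∉ σ true (subst (_∉ occupied σ) (sym (right-exit-site I)) (right-of-interval I)))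
                  (cong (λ q → st (q ∷ occupied σ) 0ℤ) q≡)
    site∈′ : ∀ {v} → v ≤ a + suc b → site a v ∈ +[1+ b ] ∷ occupied σ
    site∈′ {v} v≤ with m≤n⇒m<n∨m≡n (subst (v ≤_) (+-suc a b) v≤)
    ... | inj₁ (s≤s v≤a+b) = there (site∈ I v≤a+b)
    ... | inj₂ refl        = here (site-right-end a b)

  left-exit : Interval a b 0 σ →
              step σ false ≡ st (-[1+ a ] ∷ occupied σ) 0ℤ × Interval (suc a) b (suc a) (st (-[1+ a ] ∷ occupied σ) 0ℤ)
  left-exit I = step≡ , record
    { u≤a+b    = m≤m+n (suc a) b
    ; sites≡   = cong suc (sites≡ I)
    ; balance≡ = trans (cong (ℤ._+_ -1ℤ) (balance≡ I)) (ring (+ a) (+ b))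
    ; walker≡  = sym (ℤₚ.+-inverseʳ (+ suc a))
    ; ∈⇒site   = λ where
        (here refl) → 0 , z≤n , sym (site-left-end a)
        (there x∈)  → let v , v≤a+b , eq = ∈⇒site I x∈ in suc v , s≤s v≤a+b , trans eq (site-shift a v)
    ; site∈    = site∈′
    }
    where
    ring : ∀ A B → -1ℤ ℤ.+ (B ℤ.- A) ≡ B ℤ.- (1ℤ ℤ.+ A)
    ring = solve-∀
    site∈′ : ∀ {v} → v ≤ suc a + b → site (suc a) v ∈ -[1+ a ] ∷ occupied σ
    site∈′ {zero}  z≤n         = here (site-left-end a)
    site∈′ {suc v} (s≤s v≤a+b) = there (subst (_∈ occupied σ) (site-shift a v) (site∈ I v≤a+b))
    step≡ : step σ false ≡ st (-[1+ a ] ∷ occupied σ) 0ℤ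
    step≡ = trans (step-∉ σ false (subst (_∉ occupied σ) (sym (left-exit-site I)) (left-of-interval I)))
                  (cong (λ q → st (q ∷ occupied σ) 0ℤ) (trans (left-exit-site I) (site-left-end a)))

  Φ-on-interval : ∀ {u} n → Interval a b u σ → ∀ q →
                  Φ n (st (occupied σ) q) ≡ potential (+ n) (1ℤ ℤ.+ + a ℤ.+ + b) (+ b ℤ.- + a) q
  Φ-on-interval n I q = cong₂ (λ K D → potential (+ n) K D q) (cong +_ (sites≡ I)) (balance≡ I)

  right-exit-potential : ∀ n → Interval a b (a + b) σ → Φ n (step σ true) ≡ Φ n (moveWalker σ true)
  right-exit-potential n I = begin
    Φ n (step σ true)                                 ≡⟨ cong (Φ n) (proj₁ (right-exit I)) ⟩
    potential N (+ suc (sites σ)) (1ℤ ℤ.+ balance (occupied σ)) 0ℤ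
      ≡⟨ cong₂ (λ k d → potential N (+ suc k) (1ℤ ℤ.+ d) 0ℤ) (sites≡ I) (balance≡ I) ⟩
    potential N (+ 2 ℤ.+ A ℤ.+ B) (1ℤ ℤ.+ (B ℤ.- A)) 0ℤ ≡⟨ potential-exit-right N A B ⟩
    potential N K D (1ℤ ℤ.+ B)                        ≡⟨ cong (potential N K D) (trans (right-exit-site I) (site-right-end a b)) ⟨
    potential N K D (move (walker σ) true)            ≡⟨ Φ-on-interval n I (move (walker σ) true) ⟨
    Φ n (moveWalker σ true)                           ∎
    where
    open ≡-Reasoning
    N = + n
    A = + a
    B = + b
    K = 1ℤ ℤ.+ A ℤ.+ B
    D = B ℤ.- A

  left-exit-potential : ∀ n → Interval a b 0 σ → Φ n (step σ false) ≡ Φ n (moveWalker σ false)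
  left-exit-potential n I = begin
    Φ n (step σ false)                                 ≡⟨ cong (Φ n) (proj₁ (left-exit I)) ⟩
    potential N (+ suc (sites σ)) (-1ℤ ℤ.+ balance (occupied σ)) 0ℤ
      ≡⟨ cong₂ (λ k d → potential N (+ suc k) (-1ℤ ℤ.+ d) 0ℤ) (sites≡ I) (balance≡ I) ⟩
    potential N (+ 2 ℤ.+ A ℤ.+ B) (-1ℤ ℤ.+ (B ℤ.- A)) 0ℤ ≡⟨ potential-exit-left N A B ⟩
    potential N K D (ℤ.- (1ℤ ℤ.+ A))                   ≡⟨ cong (potential N K D) (trans (left-exit-site I) (site-left-end a)) ⟨
    potential N K D (move (walker σ) false)            ≡⟨ Φ-on-interval n I (move (walker σ) false) ⟨
    Φ n (moveWalker σ false)                           ∎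
    where
    open ≡-Reasoning
    N = + n
    A = + a
    B = + b
    K = 1ℤ ℤ.+ A ℤ.+ B
    D = B ℤ.- A

Reachable : State → Set
Reachable σ = ∃[ a ] ∃[ b ] ∃[ u ] Interval a b u σ

reachable-via : ∀ {σ τ a b u} → σ ≡ τ → Interval a b u τ → Reachable σ
reachable-via {a = a} {b} {u} refl I = a , b , u , I

step-reachable : ∀ {σ} → Reachable σ → ∀ d → Reachable (step σ d)
step-reachable (a , b , u , I) true with m≤n⇒m<n∨m≡n (u≤a+b I)
... | inj₁ u<a+b = uncurry reachable-via (right-inside I u<a+b)
... | inj₂ refl  = uncurry reachable-via (right-exit I)
step-reachable (a , b , zero , I)  false = uncurry reachable-via (left-exit I)
step-reachable (a , b , suc u , I) false = uncurry reachable-via (left-inside I)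

step-potential : ∀ n {σ} → Reachable σ → ∀ d → Φ n (step σ d) ≡ Φ n (moveWalker σ d)
step-potential n (a , b , u , I) true with m≤n⇒m<n∨m≡n (u≤a+b I)
... | inj₁ u<a+b = cong (Φ n) (proj₁ (right-inside I u<a+b))
... | inj₂ refl  = right-exit-potential n I
step-potential n (a , b , zero , I) false  = left-exit-potential n I
step-potential n (a , b , suc u , I) false = cong (Φ n) (proj₁ (left-inside I))

runFrom-reachable : ∀ {σ} → Reachable σ → ∀ s → Reachable (runFrom σ s)
runFrom-reachable R []      = R
runFrom-reachable R (d ∷ s) = runFrom-reachable (step-reachable R d) s

run-reachable : ∀ s → Reachable (run s)
run-reachable = runFrom-reachable (0 , 0 , 0 , initial-interval)

Φ-bounded : ∀ n {σ} → Reachable σ → sites σ ≤ n → ℤ.∣ Φ n σ ∣ ≤ magnitude Potential₄ (n + n)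
Φ-bounded n {σ} (a , b , u , I) sites≤n =
  potential-bounded (+ n) (+ sites σ) (balance (occupied σ)) (walker σ)
                    (m≤m+n n n) (≤-trans sites≤n (m≤m+n n n)) balance≤ walker≤
  where
  a+b<n : a + b < n
  a+b<n = subst (_≤ n) (sites≡ I) sites≤n
  balance≤ : ℤ.∣ balance (occupied σ) ∣ ≤ n + n
  balance≤ = begin
    ℤ.∣ balance (occupied σ) ∣ ≡⟨ cong ℤ.∣_∣ (balance≡ I) ⟩
    ℤ.∣ + b ℤ.- + a ∣          ≤⟨ ℤₚ.∣i-j∣≤∣i∣+∣j∣ (+ b) (+ a) ⟩
    b + a                      ≡⟨ +-comm b a ⟩
    a + b                      ≤⟨ ≤-trans (<⇒≤ a+b<n) (m≤m+n n n) ⟩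
    n + n                      ∎
    where open ≤-Reasoning
  walker≤ : ℤ.∣ walker σ ∣ ≤ n + n
  walker≤ = begin
    ℤ.∣ walker σ ∣     ≡⟨ cong ℤ.∣_∣ (walker≡ I) ⟩
    ℤ.∣ site a u ∣     ≤⟨ ℤₚ.∣i-j∣≤∣i∣+∣j∣ (+ u) (+ a) ⟩
    u + a              ≤⟨ +-mono-≤ (≤-trans (u≤a+b I) (<⇒≤ a+b<n)) (≤-trans (m≤m+n a b) (<⇒≤ a+b<n)) ⟩
    n + n              ∎
    where open ≤-Reasoning

replicate-+ : ∀ {A : Set} m k (x : A) → replicate (m + k) x ≡ replicate m x ++ replicate k x
replicate-+ zero    k x = refl
replicate-+ (suc m) k x = cong (x ∷_) (replicate-+ m k x)

right-run : ∀ {a b u σ} j {k} → Interval a b u σ → u + j ≡ a + b → j < k →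
            sites σ < sites (runFrom σ (replicate k true))
right-run {a} {b} {u} {σ} zero {suc k} I u+0≡a+b _ =
  ≤-trans (≤-reflexive (cong sites (sym (proj₁ (right-exit I′))))) (sites-≤-runFrom (step σ true) (replicate k true))
  where I′ = subst (λ u → Interval a b u σ) (trans (sym (+-identityʳ u)) u+0≡a+b) I
right-run {a} {b} {u} {σ} (suc j) {suc k} I u+1+j≡a+b (s≤s j<k) =
  subst (λ τ → sites σ < sites (runFrom τ (replicate k true))) (sym step≡) (right-run j I⁺ u+1+j≡a+b′ j<k)
  where
  u<a+b = subst (u <_) u+1+j≡a+b (m<m+n u z<s)
  step≡ = proj₁ (right-inside I u<a+b)
  I⁺ = proj₂ (right-inside I u<a+b)
  u+1+j≡a+b′ = trans (sym (+-suc u j)) u+1+j≡a+b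

sites-grow : ∀ {σ k} → Reachable σ → sites σ ≤ k → sites σ < sites (runFrom σ (replicate k true))
sites-grow {σ} {k} (a , b , u , I) sites≤k =
  right-run (a + b ∸ u) I (m+[n∸m]≡n (u≤a+b I)) (<-≤-trans (s≤s (m∸n≤m (a + b) u)) (subst (_≤ k) (sites≡ I) sites≤k))

heads-reach : ∀ n i {σ} → Reachable σ → n ≤ i + sites σ → n ≤ sites (runFrom σ (replicate (i * n) true))
heads-reach n zero    R n≤sites = n≤sites
heads-reach n (suc i) {σ} R n≤1+i+sites with n ≤? sites σ
... | yes n≤sites = ≤-trans n≤sites (sites-≤-runFrom σ (replicate (suc i * n) true))
... | no  n≰sites = subst (λ τ → n ≤ sites τ) runs≡ (heads-reach n i (runFrom-reachable R (replicate n true)) n≤i+sites′)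
  where
  σ′ = runFrom σ (replicate n true)
  n≤i+sites′ : n ≤ i + sites σ′
  n≤i+sites′ = ≤-trans n≤1+i+sites (≤-trans (≤-reflexive (sym (+-suc i (sites σ))))
                                              (+-monoʳ-≤ i (sites-grow R (<⇒≤ (≰⇒> n≰sites)))))
  runs≡ : runFrom σ′ (replicate (i * n) true) ≡ runFrom σ (replicate (suc i * n) true)
  runs≡ = trans (sym (Listₚ.foldl-++ step σ (replicate n true) (replicate (i * n) true)))
                (cong (runFrom σ) (sym (replicate-+ n (i * n) true)))

heads-finish : ∀ n s → n ≤ size (s ++ replicate (n * n) true)
heads-finish n s = subst (λ τ → n ≤ sites τ) (sym (run-++ s (replicate (n * n) true)))
                         (heads-reach n n (run-reachable s) (m≤m+n n (size s)))

-- The hitting time of n sites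

error-recurrence : ∀ H R R′ → H ℤ.+ R′ ≡ R ℤ.+ R → + 2 ℤ.* ℤ.- R ℤ.+ H ≡ ℤ.- R′
error-recurrence H R R′ eq = begin
  + 2 ℤ.* ℤ.- R ℤ.+ H      ≡⟨ ring₁ R H ⟩
  H ℤ.- (R ℤ.+ R)          ≡⟨ cong (ℤ._-_ H) eq ⟨
  H ℤ.- (H ℤ.+ R′)         ≡⟨ ring₂ H R′ ⟩
  ℤ.- R′                   ∎
  where
  open ≡-Reasoning
  ring₁ : ∀ R H → + 2 ℤ.* ℤ.- R ℤ.+ H ≡ H ℤ.- (R ℤ.+ R)
  ring₁ = solve-∀
  ring₂ : ∀ H R′ → H ℤ.- (H ℤ.+ R′) ≡ ℤ.- R′
  ring₂ = solve-∀

martingale-step : ∀ {C M T X Y F} → C ≡ + 12 ℤ.* M → X ℤ.+ Y ≡ + 2 ℤ.* F ℤ.- + 24 ℤ.* M →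
                  (C ℤ.* (1ℤ ℤ.+ T) ℤ.+ X) ℤ.+ (C ℤ.* (1ℤ ℤ.+ T) ℤ.+ Y) ≡ (C ℤ.* T ℤ.+ F) ℤ.+ (C ℤ.* T ℤ.+ F)
martingale-step {M = M} {T} {X} {Y} {F} refl X+Y≡ = begin
  (+ 12 ℤ.* M ℤ.* (1ℤ ℤ.+ T) ℤ.+ X) ℤ.+ (+ 12 ℤ.* M ℤ.* (1ℤ ℤ.+ T) ℤ.+ Y)
    ≡⟨ ring₁ M T X Y ⟩
  + 24 ℤ.* M ℤ.* (1ℤ ℤ.+ T) ℤ.+ (X ℤ.+ Y)
    ≡⟨ cong (ℤ._+_ (+ 24 ℤ.* M ℤ.* (1ℤ ℤ.+ T))) X+Y≡ ⟩
  + 24 ℤ.* M ℤ.* (1ℤ ℤ.+ T) ℤ.+ (+ 2 ℤ.* F ℤ.- + 24 ℤ.* M)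
    ≡⟨ ring₂ M T F ⟩
  (+ 12 ℤ.* M ℤ.* T ℤ.+ F) ℤ.+ (+ 12 ℤ.* M ℤ.* T ℤ.+ F) ∎
  where
  open ≡-Reasoning
  ring₁ : ∀ M T X Y → (+ 12 ℤ.* M ℤ.* (1ℤ ℤ.+ T) ℤ.+ X) ℤ.+ (+ 12 ℤ.* M ℤ.* (1ℤ ℤ.+ T) ℤ.+ Y)
                      ≡ + 24 ℤ.* M ℤ.* (1ℤ ℤ.+ T) ℤ.+ (X ℤ.+ Y)
  ring₁ = solve-∀
  ring₂ : ∀ M T F → + 24 ℤ.* M ℤ.* (1ℤ ℤ.+ T) ℤ.+ (+ 2 ℤ.* F ℤ.- + 24 ℤ.* M)
                    ≡ (+ 12 ℤ.* M ℤ.* T ℤ.+ F) ℤ.+ (+ 12 ℤ.* M ℤ.* T ℤ.+ F)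
  ring₂ = solve-∀

module _ (k : ℕ) where

  private
    n = 2 + k

  finished : List Bool → Bool
  finished s = n ≤ᵇ size s

  hits : ℕ → ℕ
  hits t = ∑ (seqs t) (λ s → 𝟙 (firstHit n s))

  survivors : ℕ → ℕ
  survivors t = ∑ (seqs t) (λ s → 𝟙 (not (finished s)))

  drift : ℕ
  drift = 12 * (n ∸ 1)

  survivorValue : ℕ → List Bool → ℤ
  survivorValue t s = if finished s then 0ℤ else + drift ℤ.* + t ℤ.+ Φ n (run s)

  survivorTotal : ℕ → ℤ
  survivorTotal t = ℤ∑.∑ (seqs t) (survivorValue t)

  finished⇒≤ : ∀ s → finished s ≡ true → n ≤ size s
  finished⇒≤ s fin = ≤ᵇ⇒≤ n (size s) (subst T (sym fin) _)

  ≤⇒finished : ∀ s → n ≤ size s → finished s ≡ true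
  ≤⇒finished s n≤size = Equivalence.to Boolₚ.T-≡ (≤⇒≤ᵇ n≤size)

  finished-∷ʳ : ∀ s d → finished s ≡ true → finished (s ∷ʳ d) ≡ true
  finished-∷ʳ s d fin = ≤⇒finished (s ∷ʳ d) (≤-trans (finished⇒≤ s fin) (size-≤-++ s (d ∷ [])))

  unfinished⇒< : ∀ s → finished s ≡ false → size s < n
  unfinished⇒< s unfin = ≰⇒> (λ n≤size → subst T unfin (≤⇒≤ᵇ n≤size))

  Φ-at-finish : ∀ s d → finished s ≡ false → finished (s ∷ʳ d) ≡ true → Φ n (moveWalker (run s) d) ≡ 0ℤ
  Φ-at-finish s d unfin fin = begin
    Φ n (moveWalker (run s) d)   ≡⟨ step-potential n (run-reachable s) d ⟨
    Φ n (step (run s) d)         ≡⟨ Φ-final n (step (run s) d) sites≡n walker≡0 ⟩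
    0ℤ                           ∎
    where
    open ≡-Reasoning
    size<n = unfinished⇒< s unfin
    n≤sites : n ≤ sites (step (run s) d)
    n≤sites = subst (λ σ → n ≤ sites σ) (run-∷ʳ s d) (finished⇒≤ (s ∷ʳ d) fin)
    grown : sites (step (run s) d) ≡ suc (size s) × walker (step (run s) d) ≡ 0ℤ
    grown with step-sites (run s) d
    ... | inj₁ same = ⊥-elim (<⇒≱ size<n (subst (n ≤_) same n≤sites))
    ... | inj₂ g    = g
    sites≡n = ≤-antisym (subst (_≤ n) (sym (proj₁ grown)) size<n) n≤sites
    walker≡0 = proj₂ grown

  hit+survivor-∷ʳ : ∀ s d → 𝟙 (firstHit n (s ∷ʳ d)) + 𝟙 (not (finished (s ∷ʳ d))) ≡ 𝟙 (not (finished s))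
  hit+survivor-∷ʳ s d rewrite firstHit-∷ʳ n s d with finished s in fin | finished (s ∷ʳ d) in fin′
  ... | true  | true  = refl
  ... | true  | false with () ← trans (sym (finished-∷ʳ s d fin)) fin′
  ... | false | true  = refl
  ... | false | false = refl

  activeValue : ℕ → List Bool → ℤ
  activeValue t s = (+ drift ℤ.* + t) ℤ.* + 𝟙 (firstHit n s) ℤ.+ survivorValue t s

  activeValue-∷ʳ : ∀ t s d → activeValue (suc t) (s ∷ʳ d)
                    ≡ (if finished s then 0ℤ else + drift ℤ.* + suc t ℤ.+ Φ n (moveWalker (run s) d))
  activeValue-∷ʳ t s d rewrite firstHit-∷ʳ n s d with finished s in fin | finished (s ∷ʳ d) in fin′
  ... | true  | true  = cong (ℤ._+ 0ℤ) (ℤₚ.*-zeroʳ X)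
    where X = + drift ℤ.* + suc t
  ... | true  | false with () ← trans (sym (finished-∷ʳ s d fin)) fin′
  ... | false | true  = trans (cong (ℤ._+ 0ℤ) (ℤₚ.*-identityʳ X)) (cong (ℤ._+_ X) (sym (Φ-at-finish s d fin fin′)))
    where X = + drift ℤ.* + suc t
  ... | false | false = begin
    X ℤ.* 0ℤ ℤ.+ (X ℤ.+ Φ n (run (s ∷ʳ d)))   ≡⟨ cong (ℤ._+ (X ℤ.+ Φ n (run (s ∷ʳ d)))) (ℤₚ.*-zeroʳ X) ⟩
    0ℤ ℤ.+ (X ℤ.+ Φ n (run (s ∷ʳ d)))         ≡⟨ ℤₚ.+-identityˡ (X ℤ.+ Φ n (run (s ∷ʳ d))) ⟩
    X ℤ.+ Φ n (run (s ∷ʳ d))                  ≡⟨ cong (λ σ → X ℤ.+ Φ n σ) (run-∷ʳ s d) ⟩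
    X ℤ.+ Φ n (step (run s) d)                ≡⟨ cong (ℤ._+_ X) (step-potential n (run-reachable s) d) ⟩
    X ℤ.+ Φ n (moveWalker (run s) d)          ∎
    where
    open ≡-Reasoning
    X = + drift ℤ.* + suc t

  drift≡12[n-1] : + drift ≡ + 12 ℤ.* (+ n ℤ.- 1ℤ)
  drift≡12[n-1] = trans (ℤₚ.pos-* 12 (suc k)) (cong (ℤ._*_ (+ 12)) (ring (+ suc k)))
    where ring : ∀ K → K ≡ (1ℤ ℤ.+ K) ℤ.- 1ℤ
          ring = solve-∀

  activeValue-∷ʳ-both : ∀ t s → activeValue (suc t) (s ∷ʳ true) ℤ.+ activeValue (suc t) (s ∷ʳ false)
                                 ≡ survivorValue t s ℤ.+ survivorValue t s
  activeValue-∷ʳ-both t s rewrite activeValue-∷ʳ t s true | activeValue-∷ʳ t s false with finished s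
  ... | true  = refl
  ... | false = martingale-step {+ drift} {+ n ℤ.- 1ℤ} {+ t} {Φ n (moveWalker σ true)} {Φ n (moveWalker σ false)} {Φ n σ}
                                drift≡12[n-1] (Φ-drift n σ)
    where σ = run s

  hits+survivors : ∀ t → hits (suc t) + survivors (suc t) ≡ survivors t + survivors t
  hits+survivors t = begin
    hits (suc t) + survivors (suc t)
      ≡⟨ ∑-⊕ (seqs (suc t)) _ _ ⟨
    ∑ (seqs (suc t)) (λ s → 𝟙 (firstHit n s) + 𝟙 (not (finished s)))
      ≡⟨ ∑-seqs-∷ʳ t _ ⟩
    ∑ (seqs t) (λ s → (𝟙 (firstHit n (s ∷ʳ true)) + 𝟙 (not (finished (s ∷ʳ true))))
                      + (𝟙 (firstHit n (s ∷ʳ false)) + 𝟙 (not (finished (s ∷ʳ false)))))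
      ≡⟨ ∑-cong (seqs t) (λ s → cong₂ _+_ (hit+survivor-∷ʳ s true) (hit+survivor-∷ʳ s false)) ⟩
    ∑ (seqs t) (λ s → 𝟙 (not (finished s)) + 𝟙 (not (finished s)))
      ≡⟨ ∑-⊕ (seqs t) _ _ ⟩
    survivors t + survivors t ∎
    where open ≡-Reasoning

  survivorTotal-step : ∀ t → + drift ℤ.* (+ suc t ℤ.* + hits (suc t)) ℤ.+ survivorTotal (suc t)
                             ≡ survivorTotal t ℤ.+ survivorTotal t
  survivorTotal-step t = begin
    + drift ℤ.* (+ suc t ℤ.* + hits (suc t)) ℤ.+ survivorTotal (suc t)
      ≡⟨ cong (ℤ._+ survivorTotal (suc t)) hit-term ⟩
    ℤ∑.∑ (seqs (suc t)) (λ s → X ℤ.* + 𝟙 (firstHit n s)) ℤ.+ survivorTotal (suc t)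
      ≡⟨ ℤ∑.∑-⊕ (seqs (suc t)) _ _ ⟨
    ℤ∑.∑ (seqs (suc t)) (activeValue (suc t))
      ≡⟨ ℤ∑.∑-seqs-∷ʳ t _ ⟩
    ℤ∑.∑ (seqs t) (λ s → activeValue (suc t) (s ∷ʳ true) ℤ.+ activeValue (suc t) (s ∷ʳ false))
      ≡⟨ ℤ∑.∑-cong (seqs t) (activeValue-∷ʳ-both t) ⟩
    ℤ∑.∑ (seqs t) (λ s → survivorValue t s ℤ.+ survivorValue t s)
      ≡⟨ ℤ∑.∑-⊕ (seqs t) _ _ ⟩
    survivorTotal t ℤ.+ survivorTotal t ∎
    where
    open ≡-Reasoning
    X = + drift ℤ.* + suc t
    hit-term : + drift ℤ.* (+ suc t ℤ.* + hits (suc t)) ≡ ℤ∑.∑ (seqs (suc t)) (λ s → X ℤ.* + 𝟙 (firstHit n s))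
    hit-term = begin
      + drift ℤ.* (+ suc t ℤ.* + hits (suc t))                ≡⟨ ℤₚ.*-assoc (+ drift) (+ suc t) _ ⟨
      X ℤ.* + hits (suc t)                                    ≡⟨ cong (ℤ._*_ X) (pos-∑ (seqs (suc t)) _) ⟨
      X ℤ.* ℤ∑.∑ (seqs (suc t)) (λ s → + 𝟙 (firstHit n s))    ≡⟨ ℤ∑.∑-⊗ˡ (seqs (suc t)) X (λ s → + 𝟙 (firstHit n s)) ⟨
      ℤ∑.∑ (seqs (suc t)) (λ s → X ℤ.* + 𝟙 (firstHit n s))    ∎

  probT≡hits : ∀ t → probT n t ≡ (+ hits t / 2 ^ t) {{m^n≢0 2 t}}
  probT≡hits t = cong (λ m → (+ m / 2 ^ t) {{m^n≢0 2 t}}) (length-filter (firstHit n) (seqs t))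

  mass-error : ∀ t → massUpTo n (suc t) ℚ.- + 1 / 1 ≡ ((ℤ.- + survivors t) / (1 * 2 ^ t)) {{*2^-nonZero 1 t}}
  mass-error = dyadic-error (massUpTo n) (+ 1 / 1) 1 (λ t → + hits t) (λ t → ℤ.- + survivors t)
    refl
    (λ t → cong (massUpTo n (suc t) ℚ.+_) (probT≡hits (suc t)))
    (λ t → error-recurrence (+ 1 ℤ.* + hits (suc t)) (+ survivors t) (+ survivors (suc t))
             (trans (cong (ℤ._+ + survivors (suc t)) (ℤₚ.*-identityˡ (+ hits (suc t)))) (cong +_ (hits+survivors t))))

  cube+square : + (n ^ 3 + n ^ 2) ≡ + n ℤ.* + n ℤ.* + n ℤ.+ + n ℤ.* + n
  cube+square = begin
    + (n ^ 3 + n ^ 2)                      ≡⟨ cong +_ (expand n) ⟩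
    + (n * n * n) ℤ.+ + (n * n)            ≡⟨ cong₂ ℤ._+_ (trans (ℤₚ.pos-* (n * n) n) (cong (ℤ._* + n) (ℤₚ.pos-* n n)))
                                                          (ℤₚ.pos-* n n) ⟩
    + n ℤ.* + n ℤ.* + n ℤ.+ + n ℤ.* + n    ∎
    where
    open ≡-Reasoning
    expand : ∀ n → n * (n * (n * 1)) + n * (n * 1) ≡ n * n * n + n * n
    expand = ℕ-Solver.solve-∀

  Φ-initial : + 12 ℤ.* Φ n initial ≡ + (n ^ 3 + n ^ 2) ℤ.* + drift
  Φ-initial = trans (potential-initial (+ n)) (sym (cong₂ ℤ._*_ cube+square drift≡12[n-1]))

  exp-error : ∀ t → expUpTo n (suc t) ℚ.- + (n ^ 3 + n ^ 2) / 12
                    ≡ ((ℤ.- survivorTotal t) / (drift * 2 ^ t)) {{*2^-nonZero drift t}}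
  exp-error = dyadic-error (expUpTo n) (+ (n ^ 3 + n ^ 2) / 12) drift (λ t → + t ℤ.* + hits t) (λ t → ℤ.- survivorTotal t)
    base increment
    (λ t → error-recurrence (+ drift ℤ.* (+ suc t ℤ.* + hits (suc t))) (survivorTotal t) (survivorTotal (suc t))
                            (survivorTotal-step t))
    where
    Q = + (n ^ 3 + n ^ 2)
    Φ₀ = Φ n initial

    cross : ℤ.- Q ℤ.* + (drift * 1) ≡ ℤ.- survivorTotal 0 ℤ.* + 12
    cross = begin
      ℤ.- Q ℤ.* + (drift * 1)                          ≡⟨ cong (λ c → ℤ.- Q ℤ.* + c) (*-identityʳ drift) ⟩
      ℤ.- Q ℤ.* + drift                                ≡⟨ ring₁ Q (+ drift) ⟩
      ℤ.- (Q ℤ.* + drift)                              ≡⟨ cong ℤ.-_ Φ-initial ⟨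
      ℤ.- (+ 12 ℤ.* Φ₀)                                ≡⟨ ring₂ (+ drift) Φ₀ ⟩
      ℤ.- ((+ drift ℤ.* + 0 ℤ.+ Φ₀) ℤ.+ 0ℤ) ℤ.* + 12   ∎
      where
      open ≡-Reasoning
      ring₁ : ∀ Q C → ℤ.- Q ℤ.* C ≡ ℤ.- (Q ℤ.* C)
      ring₁ = solve-∀
      ring₂ : ∀ C Φ₀ → ℤ.- (+ 12 ℤ.* Φ₀) ≡ ℤ.- ((C ℤ.* + 0 ℤ.+ Φ₀) ℤ.+ 0ℤ) ℤ.* + 12
      ring₂ = solve-∀

    base : expUpTo n 1 ℚ.- Q / 12 ≡ ((ℤ.- survivorTotal 0) / (drift * 1)) {{*2^-nonZero drift 0}}
    base = begin
      0ℚ ℚ.- Q / 12                      ≡⟨ ℚₚ.+-identityˡ (ℚ.- (Q / 12)) ⟩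
      ℚ.- (Q / 12)                       ≡⟨ -‿/ Q 12 ⟩
      (ℤ.- Q) / 12                       ≡⟨ /-cross (ℤ.- Q) (ℤ.- survivorTotal 0) {{_}} {{*2^-nonZero drift 0}} cross ⟩
      (ℤ.- survivorTotal 0) / (drift * 1) ∎
      where open ≡-Reasoning

    increment : ∀ t → expUpTo n (suc (suc t))
                      ≡ expUpTo n (suc t) ℚ.+ ((+ suc t ℤ.* + hits (suc t)) / 2 ^ suc t) {{m^n≢0 2 (suc t)}}
    increment t = cong (expUpTo n (suc t) ℚ.+_) (begin
      (+ suc t / 1) ℚ.* probT n (suc t)
        ≡⟨ cong ((+ suc t / 1) ℚ.*_) (probT≡hits (suc t)) ⟩
      (+ suc t / 1) ℚ.* (+ hits (suc t) / 2 ^ suc t) {{2^t+1≢0}}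
        ≡⟨ *-/ (+ suc t) (+ hits (suc t)) 1 (2 ^ suc t) {{_}} {{2^t+1≢0}} ⟩
      (i / (1 * 2 ^ suc t)) {{1*2^t+1≢0}}
        ≡⟨ ℚₚ./-cong {i} {1 * 2 ^ suc t} {i} {2 ^ suc t} {{1*2^t+1≢0}} {{2^t+1≢0}} refl (*-identityˡ (2 ^ suc t)) ⟩
      (i / 2 ^ suc t) {{2^t+1≢0}} ∎)
      where
      open ≡-Reasoning
      i = + suc t ℤ.* + hits (suc t)
      2^t+1≢0 = m^n≢0 2 (suc t)
      1*2^t+1≢0 = *2^-nonZero 1 (suc t)

  survivors≤2^ : ∀ t → survivors t ≤ 2 ^ t
  survivors≤2^ t = ≤-trans (∑-≤-length (seqs t) (λ s → 𝟙≤1 (not (finished s)))) (≤-reflexive (length-seqs t))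

  survivors-contract : ∀ t → survivors (t + n * n) ≤ pred (2 ^ (n * n)) * survivors t
  survivors-contract t = begin
    survivors (t + n * n)
      ≡⟨ ∑-seqs-+ t (n * n) _ ⟩
    ∑ (seqs t) (λ u → ∑ (seqs (n * n)) (λ v → 𝟙 (not (finished (u ++ v)))))
      ≤⟨ ∑-mono-≤ (seqs t) continuations ⟩
    ∑ (seqs t) (λ u → pred (2 ^ (n * n)) * 𝟙 (not (finished u)))
      ≡⟨ ∑-⊗ˡ (seqs t) (pred (2 ^ (n * n))) _ ⟩
    pred (2 ^ (n * n)) * survivors t ∎
    where
    open ≤-Reasoning
    continuations : ∀ u → ∑ (seqs (n * n)) (λ v → 𝟙 (not (finished (u ++ v))))
                          ≤ pred (2 ^ (n * n)) * 𝟙 (not (finished u))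
    continuations u with finished u in fin
    ... | true  = ≤-trans (≤-reflexive (trans (∑-cong (seqs (n * n)) all-finished) (∑-0# (seqs (n * n))))) z≤n
      where
      all-finished : ∀ v → 𝟙 (not (finished (u ++ v))) ≡ 0
      all-finished v = cong (𝟙 ∘ not) (≤⇒finished (u ++ v) (≤-trans (finished⇒≤ u fin) (size-≤-++ u v)))
    ... | false = begin
      survivingTails           ≤⟨ suc[m]≤n⇒m≤pred[n] (subst (survivingTails <_) (length-seqs (n * n)) one-finishes) ⟩
      pred (2 ^ (n * n))       ≡⟨ *-identityʳ _ ⟨
      pred (2 ^ (n * n)) * 1   ∎
      where
      survivingTails = ∑ (seqs (n * n)) (λ v → 𝟙 (not (finished (u ++ v))))
      one-finishes : survivingTails < length (seqs (n * n))
      one-finishes = ∑-<-length (λ v → 𝟙≤1 (not (finished (u ++ v)))) (heads∈seqs (n * n))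
                                (cong (𝟙 ∘ not) (≤⇒finished (u ++ replicate (n * n) true) (heads-finish n u)))

  Φmax : ℕ
  Φmax = magnitude Potential₄ (n + n)

  survivorValue-bound : ∀ t s → ℤ.∣ survivorValue t s ∣ ≤ (drift + Φmax) * suc t * 𝟙 (not (finished s))
  survivorValue-bound t s with finished s in fin
  ... | true  = z≤n
  ... | false = begin
    ℤ.∣ + drift ℤ.* + t ℤ.+ Φ n (run s) ∣        ≤⟨ ℤₚ.∣i+j∣≤∣i∣+∣j∣ (+ drift ℤ.* + t) (Φ n (run s)) ⟩
    ℤ.∣ + drift ℤ.* + t ∣ + ℤ.∣ Φ n (run s) ∣    ≤⟨ +-mono-≤ (≤-reflexive (ℤₚ.abs-* (+ drift) (+ t)))
                                                          (Φ-bounded n (run-reachable s) (<⇒≤ (unfinished⇒< s fin))) ⟩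
    drift * t + Φmax                             ≤⟨ m≤m+n (drift * t + Φmax) (drift + Φmax * t) ⟩
    drift * t + Φmax + (drift + Φmax * t)        ≡⟨ rearrange drift Φmax t ⟩
    (drift + Φmax) * suc t * 1                   ∎
    where
    open ≤-Reasoning
    rearrange : ∀ C M t → C * t + M + (C + M * t) ≡ (C + M) * suc t * 1
    rearrange = ℕ-Solver.solve-∀

  survivorTotal-bound : ∀ t → ℤ.∣ survivorTotal t ∣ ≤ (drift + Φmax) * suc t * survivors t
  survivorTotal-bound t = begin
    ℤ.∣ survivorTotal t ∣                                            ≤⟨ ∣∑∣≤∑∣∣ (seqs t) (survivorValue t) ⟩
    ∑ (seqs t) (λ s → ℤ.∣ survivorValue t s ∣)                        ≤⟨ ∑-mono-≤ (seqs t) (survivorValue-bound t) ⟩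
    ∑ (seqs t) (λ s → (drift + Φmax) * suc t * 𝟙 (not (finished s)))  ≡⟨ ∑-⊗ˡ (seqs t) ((drift + Φmax) * suc t) _ ⟩
    (drift + Φmax) * suc t * survivors t                             ∎
    where open ≤-Reasoning

  private module Tail = GeometricDecay survivors (n * n) survivors≤2^ survivors-contract

  mass-converges : massUpTo n ⟶ (+ 1 / 1)
  mass-converges = ⟶-if-dyadic-error (massUpTo n) (+ 1 / 1) 1 (λ t → ℤ.- + survivors t) mass-error small
    where
    small : ∀ B → ∃[ N ] (∀ t → N ≤ t → B * ℤ.∣ ℤ.- + survivors t ∣ ≤ 2 ^ t)
    small B = let N , bound = Tail.eventually-small B in N , λ t N≤t → begin
      B * ℤ.∣ ℤ.- + survivors t ∣   ≡⟨ cong (B *_) (ℤₚ.∣-i∣≡∣i∣ (+ survivors t)) ⟩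
      B * survivors t               ≤⟨ *-monoˡ-≤ (survivors t) (m≤m*n B (suc t)) ⟩
      B * suc t * survivors t       ≤⟨ bound t N≤t ⟩
      2 ^ t                         ∎
      where open ≤-Reasoning

  exp-converges : expUpTo n ⟶ (+ (n ^ 3 + n ^ 2) / 12)
  exp-converges = ⟶-if-dyadic-error (expUpTo n) (+ (n ^ 3 + n ^ 2) / 12) drift (λ t → ℤ.- survivorTotal t) exp-error small
    where
    small : ∀ B → ∃[ N ] (∀ t → N ≤ t → B * ℤ.∣ ℤ.- survivorTotal t ∣ ≤ 2 ^ t)
    small B = let N , bound = Tail.eventually-small (B * (drift + Φmax)) in N , λ t N≤t → begin
      B * ℤ.∣ ℤ.- survivorTotal t ∣                 ≡⟨ cong (B *_) (ℤₚ.∣-i∣≡∣i∣ (survivorTotal t)) ⟩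
      B * ℤ.∣ survivorTotal t ∣                     ≤⟨ *-monoʳ-≤ B (survivorTotal-bound t) ⟩
      B * ((drift + Φmax) * suc t * survivors t)    ≡⟨ regroup B (drift + Φmax) (suc t) (survivors t) ⟩
      B * (drift + Φmax) * suc t * survivors t      ≤⟨ bound t N≤t ⟩
      2 ^ t                                         ∎
      where
      open ≤-Reasoning
      regroup : ∀ B K T R → B * (K * T * R) ≡ B * K * T * R
      regroup = ℕ-Solver.solve-∀

theorem2 : ∀ (n : ℕ) → 2 ≤ n →
    (massUpTo n ⟶ (+ 1 / 1)) × (expUpTo n ⟶ (+ (n ^ 3 + n ^ 2) / 12))
theorem2 (suc (suc k)) (s≤s (s≤s z≤n)) = mass-converges k , exp-converges k
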